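{- For all positive integers $n$ and all $k\in\{0,1,\dots,n\}$, the polytope $\mathcal{M}_k(K_{n,n})$ is normal.
   Context: $\mathcal{M}_k(K_{n,n})=\operatorname{conv}\{\chi(M): M \text{ is a matching of } K_{n,n} \text{ with exactly } k \text{ edges}\}$, where $\chi(M)$ is the $0/1$ indicator vector of $M$ in $\mathbb{R}^{E(K_{n,n})}$. A polytope $P$ is normal if for every positive integer $t$, every integer point of $tP=\{tx:x\in P\}$ is a sum of $t$ integer points of $P$.
   Formalization: The polytope $\mathcal{M}_k(K_{n,n})$ and its dilates consist of rational points, convex combinations of the vectors χ(M) with rational coefficients, rather than of points of $\mathbb{R}^{E(K_{n,n})}$. -}

module Defs where

open import Data.Nat using (ℕ; zero; suc)
import Data.Nat as ℕ
open import Data.Integer using (ℤ; +_)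
import Data.Integer as ℤ
open import Data.Rational using (ℚ; _/_; 0ℚ; 1ℚ; _≤_)
import Data.Rational as ℚ
open import Data.Fin using (Fin)
open import Data.Bool using (Bool; true; false; if_then_else_)
open import Data.List using (List; []; _∷_)
open import Data.Vec using (Vec; []; _∷_)
open import Data.Product using (Σ; _×_; _,_; proj₁; proj₂; ∃)
open import Relation.Binary.PropositionalEquality using (_≡_)

sumFinℕ : ∀ {n} → (Fin n → ℕ) → ℕ
sumFinℕ {zero}  f = 0
sumFinℕ {suc n} f = f Fin.zero ℕ.+ sumFinℕ (λ i → f (Fin.suc i))
  where import Data.Fin as Fin

-- Edges of K_{n,n}: pairs (i , j), i a left vertex, j a right vertex.
-- An edge set of K_{n,n}, given by its membership predicate.
EdgeSet : ℕ → Set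
EdgeSet n = Fin n → Fin n → Bool

IsMatching : ∀ {n} → EdgeSet n → Set
IsMatching {n} M =
  (∀ (i : Fin n) (j j′ : Fin n) → M i j ≡ true → M i j′ ≡ true → j ≡ j′) ×
  (∀ (i i′ : Fin n) (j : Fin n) → M i j ≡ true → M i′ j ≡ true → i ≡ i′)

numEdges : ∀ {n} → EdgeSet n → ℕ
numEdges M = sumFinℕ (λ i → sumFinℕ (λ j → if M i j then 1 else 0))

KMatching : ℕ → ℕ → Set
KMatching n k = Σ (EdgeSet n) (λ M → IsMatching M × numEdges M ≡ k)

QPoint : ℕ → Set
QPoint n = Fin n → Fin n → ℚ

ZPoint : ℕ → Set
ZPoint n = Fin n → Fin n → ℤ

toQ : ∀ {n} → ZPoint n → QPoint n
toQ x i j = x i j / 1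

χ : ∀ {n} → EdgeSet n → QPoint n
χ M i j = if M i j then 1ℚ else 0ℚ

-- Convex combinations: finite lists of (coefficient , k-matching).
sumCoeffs : ∀ {n k} → List (ℚ × KMatching n k) → ℚ
sumCoeffs []             = 0ℚ
sumCoeffs ((λ₀ , _) ∷ L) = λ₀ ℚ.+ sumCoeffs L

combo : ∀ {n k} → List (ℚ × KMatching n k) → QPoint n
combo []                   i j = 0ℚ
combo ((λ₀ , (M , _)) ∷ L) i j = λ₀ ℚ.* χ M i j ℚ.+ combo L i j

AllNonneg : ∀ {n k} → List (ℚ × KMatching n k) → Set
AllNonneg []             = Data.Unit.⊤
  where import Data.Unit
AllNonneg ((λ₀ , _) ∷ L) = (0ℚ ≤ λ₀) × AllNonneg L

InMk : (n k : ℕ) → QPoint n → Set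
InMk n k y = Σ (List (ℚ × KMatching n k)) λ L →
  AllNonneg L × sumCoeffs L ≡ 1ℚ × (∀ i j → y i j ≡ combo L i j)

InDilate : (n k t : ℕ) → QPoint n → Set
InDilate n k t x = Σ (QPoint n) λ y →
  InMk n k y × (∀ i j → x i j ≡ (+ t / 1) ℚ.* y i j)

sumPts : ∀ {n t} → Vec (ZPoint n) t → ZPoint n
sumPts []       i j = + 0
sumPts (p ∷ ps) i j = p i j ℤ.+ sumPts ps i j

AllIn : ∀ {n t} → (ZPoint n → Set) → Vec (ZPoint n) t → Set
AllIn P []       = Data.Unit.⊤
  where import Data.Unit
AllIn P (p ∷ ps) = P p × AllIn P ps

MkNormal : ℕ → ℕ → Set
MkNormal n k = ∀ (t : ℕ) → 1 ℕ.≤ t → (x : ZPoint n) → InDilate n k t (toQ x) →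
  Σ (Vec (ZPoint n) t) λ ps →
    AllIn (λ p → InMk n k (toQ p)) ps × (∀ i j → x i j ≡ sumPts ps i j)

module Submission where

-- An integer point x of t·M_k(K_{n,n}) is a nonnegative integer matrix whose row and column sums are at
-- most t and whose entries add up to t·k: each of these sums is a linear functional that is at most 1
-- (respectively exactly k) on every vertex χ(M). Read as a bipartite multigraph of maximum degree at most t,
-- x splits into t matchings by König's edge-colouring theorem; an uncoloured edge ij is added after
-- swapping the alternating path of two colours that starts at j. While some colour class has more than k
-- edges and another fewer, exchanging the two classes along an alternating path moves one edge from the
-- larger to the smaller; when all classes have exactly k edges, x is a sum of t vertices of M_k(K_{n,n}).

open import Defs
open import Algebra.Bundles using (Ring)
open import Data.Bool using (Bool; true; false; if_then_else_)
open import Data.Fin using (Fin; zero; suc; punchIn)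
open import Data.Fin.Properties using (_≟_; any?; punchInᵢ≢i; suc-injective)
open import Data.Integer as ℤ using (ℤ; -[1+_])
import Data.Integer.Properties as ℤ
open import Data.List using ([]; _∷_)
open import Data.Maybe using (Maybe; just; nothing)
open import Data.Maybe.Properties using (just-injective; ≡-dec)
open import Data.Nat using (ℕ; zero; suc; _+_; _*_; _∸_; _≤_; _<_; z≤n; z<s)
import Data.Nat.Coprimality as Coprime
open import Data.Nat.Induction using (<-wellFounded)
import Data.Nat.Properties as ℕ
open import Data.Product using (∃; ∃₂; _×_; _,_; proj₁; proj₂)
open import Data.Rational using (ℚ; mkℚ; _/_; 0ℚ; 1ℚ; *≤*)
import Data.Rational as ℚ
import Data.Rational.Properties as ℚ
import Data.Rational.Unnormalised as ℚᵘ
import Data.Rational.Unnormalised.Properties as ℚᵘ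
open import Data.Sum using (_⊎_; inj₁; inj₂)
open import Data.Unit using (tt)
open import Data.Vec using (tabulate)
open import Data.Vec.Functional using (updateAt)
open import Data.Vec.Functional.Properties using (updateAt-updates; updateAt-minimal)
open import Function using (_∘_)
open import Induction.WellFounded using (Acc; acc)
open import Relation.Binary.PropositionalEquality
open import Relation.Nullary using (¬_; Dec; yes; no; does; contradiction; _⊎-dec_)
open import Relation.Unary using (Decidable)

open import Algebra.Properties.Semiring.Sum ℕ.+-*-semiring
  using (sum; sum-cong-≗; sum-remove; sum-replicate-zero; ∑-distrib-+; ∑-comm; *-distribˡ-sum; *-distribʳ-sum)
open import Algebra.Properties.Semiring.Sum (Ring.semiring ℚ.+-*-ring)
  using () renaming (sum to sumℚ; sum-cong-≗ to sumℚ-cong-≗; ∑-distrib-+ to sumℚ-distrib-+;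
                     *-distribˡ-sum to *-distribˡ-sumℚ)
open import Algebra.Properties.CommutativeSemigroup ℕ.+-commutativeSemigroup
  using (xy∙z≈zy∙x; xy∙z≈xz∙y; xy∙z≈x∙zy; x∙yz≈xz∙y)

_[_]≔_ : ∀ {A : Set} {n} → (Fin n → A) → Fin n → A → Fin n → A
f [ r ]≔ v = updateAt f r (λ _ → v)

sumFinℕ≡sum : ∀ {n} (f : Fin n → ℕ) → sumFinℕ f ≡ sum f
sumFinℕ≡sum {zero}  f = refl
sumFinℕ≡sum {suc n} f = cong (f zero +_) (sumFinℕ≡sum (f ∘ suc))

m+1≡n⇒m<n : ∀ {m n} → m + 1 ≡ n → m < n
m+1≡n⇒m<n {m} refl = ℕ.m<m+n m z<s

sum-const : ∀ n c → sum {n} (λ _ → c) ≡ n * c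
sum-const zero    c = refl
sum-const (suc n) c = cong (c +_) (sum-const n c)

sum-mono-≤ : ∀ {n} {f g : Fin n → ℕ} → (∀ i → f i ≤ g i) → sum f ≤ sum g
sum-mono-≤ {zero}  f≤g = z≤n
sum-mono-≤ {suc n} f≤g = ℕ.+-mono-≤ (f≤g zero) (sum-mono-≤ (f≤g ∘ suc))

sum-mono-< : ∀ {n} {f g : Fin n → ℕ} a → (∀ i → f i ≤ g i) → f a < g a → sum f < sum g
sum-mono-< zero    f≤g fa<ga = ℕ.+-mono-<-≤ fa<ga (sum-mono-≤ (f≤g ∘ suc))
sum-mono-< (suc a) f≤g fa<ga = ℕ.+-mono-≤-< (f≤g zero) (sum-mono-< a (f≤g ∘ suc) fa<ga)

positive⇒≤sum : ∀ {n} {f : Fin n → ℕ} → (∀ i → 0 < f i) → n ≤ sum f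
positive⇒≤sum {zero}  pos = z≤n
positive⇒≤sum {suc n} pos = ℕ.+-mono-≤ (pos zero) (positive⇒≤sum (pos ∘ suc))

≤-sum : ∀ {n} (f : Fin n → ℕ) a → f a ≤ sum f
≤-sum f zero    = ℕ.m≤m+n _ _
≤-sum f (suc a) = ℕ.≤-trans (≤-sum (f ∘ suc) a) (ℕ.m≤n+m _ (f zero))

sum≡n*k⇒≡k : ∀ {n} (f : Fin n → ℕ) {k} → sum f ≡ n * k → (∀ i → f i ≤ k) → ∀ i → f i ≡ k
sum≡n*k⇒≡k {n} f {k} ∑f≡nk f≤k i = ℕ.≤-antisym (f≤k i) (ℕ.≮⇒≥ λ fi<k →
  ℕ.<-irrefl (trans ∑f≡nk (sym (sum-const n k))) (sum-mono-< i f≤k fi<k))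

sum≡n*k⇒deficit : ∀ {n} (f : Fin n → ℕ) {k a} → sum f ≡ n * k → k < f a → ∃ λ b → f b < k
sum≡n*k⇒deficit {n} f {k} {a} ∑f≡nk k<fa with any? (λ b → f b ℕ.<? k)
... | yes found = found
... | no  none  = contradiction (sum-mono-< a (λ b → ℕ.≮⇒≥ λ fb<k → none (b , fb<k)) k<fa)
                                (ℕ.<-irrefl (trans (sum-const n k) (sym ∑f≡nk)))

sum-except : ∀ {n} (f g : Fin n → ℕ) a → (∀ i → i ≢ a → f i ≡ g i) → sum f + g a ≡ sum g + f a
sum-except {suc n} f g a f≡g = begin
  sum f + g a                     ≡⟨ cong (_+ g a) (sum-remove {i = a} f) ⟩
  f a + sum (f ∘ punchIn a) + g a ≡⟨ cong (λ s → f a + s + g a) (sum-cong-≗ λ i → f≡g _ (punchInᵢ≢i a i)) ⟩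
  f a + sum (g ∘ punchIn a) + g a ≡⟨ xy∙z≈zy∙x (f a) _ (g a) ⟩
  g a + sum (g ∘ punchIn a) + f a ≡⟨ cong (_+ f a) (sum-remove {i = a} g) ⟨
  sum g + f a                     ∎
  where open ≡-Reasoning

sum-except₂ : ∀ {n} (f g : Fin n → ℕ) {a b} → a ≢ b → (∀ i → i ≢ a → i ≢ b → f i ≡ g i) →
  sum f + (g a + g b) ≡ sum g + (f a + f b)
sum-except₂ f g {a} {b} a≢b f≡g = begin
  sum f + (g a + g b) ≡⟨ ℕ.+-assoc (sum f) _ _ ⟨
  sum f + g a + g b   ≡⟨ cong (λ x → sum f + x + g b) (updateAt-updates a f) ⟨
  sum f + h a + g b   ≡⟨ cong (_+ g b) (sum-except f h a λ i i≢a → sym (updateAt-minimal i a f i≢a)) ⟩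
  sum h + f a + g b   ≡⟨ xy∙z≈xz∙y (sum h) (f a) (g b) ⟩
  sum h + g b + f a   ≡⟨ cong (_+ f a) (sum-except h g b h≡g) ⟩
  sum g + h b + f a   ≡⟨ cong (λ x → sum g + x + f a) (updateAt-minimal b a f (a≢b ∘ sym)) ⟩
  sum g + f b + f a   ≡⟨ xy∙z≈x∙zy (sum g) (f b) (f a) ⟩
  sum g + (f a + f b) ∎
  where
  open ≡-Reasoning
  h = f [ a ]≔ g a
  h≡g : ∀ i → i ≢ b → h i ≡ g i
  h≡g i i≢b with i ≟ a
  ... | yes refl = updateAt-updates a f
  ... | no  i≢a  = trans (updateAt-minimal i a f i≢a) (f≡g i i≢a i≢b)

sum-cong-except₂ : ∀ {n} (f g : Fin n → ℕ) {a b} → a ≢ b → (∀ i → i ≢ a → i ≢ b → f i ≡ g i) →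
  f a + f b ≡ g a + g b → sum f ≡ sum g
sum-cong-except₂ f g {a} {b} a≢b f≡g fab≡gab = ℕ.+-cancelʳ-≡ _ (sum f) (sum g) (begin
  sum f + (g a + g b) ≡⟨ sum-except₂ f g a≢b f≡g ⟩
  sum g + (f a + f b) ≡⟨ cong (sum g +_) fab≡gab ⟩
  sum g + (g a + g b) ∎)
  where open ≡-Reasoning

data SamePair {A : Set} : A → A → A → A → Set where
  same : ∀ {u v} → SamePair u v u v
  swap : ∀ {u v} → SamePair u v v u

module _ {A : Set} {u v u′ v′ : A} where

  samePair-resp : ∀ {u₀ v₀ u₀′ v₀′} → u ≡ u₀ → v ≡ v₀ → u′ ≡ u₀′ → v′ ≡ v₀′ →
    SamePair u₀ v₀ u₀′ v₀′ → SamePair u v u′ v′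
  samePair-resp refl refl refl refl p = p

  samePair-all : ∀ {ℓ} (P : A → Set ℓ) → SamePair u v u′ v′ → P u → P v → P u′ × P v′
  samePair-all P same Pu Pv = Pu , Pv
  samePair-all P swap Pu Pv = Pv , Pu

  samePair-flip : SamePair u v u′ v′ → SamePair u v v′ u′
  samePair-flip same = swap
  samePair-flip swap = same

  samePair-inv : SamePair u v u′ v′ → (u′ ≡ u × v′ ≡ v) ⊎ (u′ ≡ v × v′ ≡ u)
  samePair-inv same = inj₁ (refl , refl)
  samePair-inv swap = inj₂ (refl , refl)

  samePair-+ : (h : A → ℕ) → SamePair u v u′ v′ → h u + h v ≡ h u′ + h v′
  samePair-+ h same = refl
  samePair-+ h swap = ℕ.+-comm (h u) (h v)

𝟙 : Bool → ℕ
𝟙 b = if b then 1 else 0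

Matrix : ℕ → Set
Matrix n = Fin n → Fin n → ℕ

module _ {n : ℕ} where

  degree : Maybe (Fin n) → ℕ
  degree nothing  = 0
  degree (just _) = 1

  isMate : Maybe (Fin n) → Fin n → Bool
  isMate nothing  q = false
  isMate (just c) q = does (c ≟ q)

  incidence : Maybe (Fin n) → Fin n → ℕ
  incidence v q = 𝟙 (isMate v q)

  isMate⇒≡ : ∀ v q → isMate v q ≡ true → v ≡ just q
  isMate⇒≡ (just c) q _ with c ≟ q
  ... | yes refl = refl

  incidence-self : ∀ c → incidence (just c) c ≡ 1
  incidence-self c with c ≟ c
  ... | yes _  = refl
  ... | no c≢c = contradiction refl c≢c

  incidence-≢ : ∀ v q → v ≢ just q → incidence v q ≡ 0
  incidence-≢ nothing  q _    = refl
  incidence-≢ (just c) q v≢q with c ≟ q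
  ... | yes refl = contradiction refl v≢q
  ... | no  _    = refl

  ∑-incidence : ∀ v → sum (incidence v) ≡ degree v
  ∑-incidence nothing  = sum-replicate-zero n
  ∑-incidence (just c) = ℕ.+-cancelʳ-≡ 0 _ _ (begin
    sum (incidence (just c)) + 0             ≡⟨ sum-except (incidence (just c)) (λ _ → 0) c off-c ⟩
    sum {n} (λ _ → 0) + incidence (just c) c ≡⟨ cong₂ _+_ (sum-replicate-zero n) (incidence-self c) ⟩
    1 + 0                                    ∎)
    where
    open ≡-Reasoning
    off-c : ∀ q → q ≢ c → incidence (just c) q ≡ 0
    off-c q q≢c = incidence-≢ (just c) q (q≢c ∘ sym ∘ just-injective)

  rowSum colSum : Matrix n → Fin n → ℕ
  rowSum X p = sum (X p)
  colSum X q = sum (λ p → X p q)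

  total : Matrix n → ℕ
  total X = sum (rowSum X)

  unit : Fin n → Fin n → Matrix n
  unit i j p q = incidence (just i) p * incidence (just j) q

  rowSum-unit : ∀ (i j p : Fin n) → rowSum (unit i j) p ≡ incidence (just i) p
  rowSum-unit i j p = begin
    sum (λ q → incidence (just i) p * incidence (just j) q)
      ≡⟨ *-distribˡ-sum (incidence (just i) p) (incidence (just j)) ⟨
    incidence (just i) p * sum (incidence (just j))
      ≡⟨ cong (incidence (just i) p *_) (∑-incidence (just j)) ⟩
    incidence (just i) p * 1
      ≡⟨ ℕ.*-identityʳ _ ⟩
    incidence (just i) p ∎
    where open ≡-Reasoning

  colSum-unit : ∀ (i j q : Fin n) → colSum (unit i j) q ≡ incidence (just j) q
  colSum-unit i j q = begin
    sum (λ p → incidence (just i) p * incidence (just j) q)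
      ≡⟨ *-distribʳ-sum (incidence (just j) q) (incidence (just i)) ⟨
    sum (incidence (just i)) * incidence (just j) q
      ≡⟨ cong (_* incidence (just j) q) (∑-incidence (just i)) ⟩
    1 * incidence (just j) q
      ≡⟨ ℕ.*-identityˡ _ ⟩
    incidence (just j) q ∎
    where open ≡-Reasoning

  size : (Fin n → Maybe (Fin n)) → ℕ
  size f = sum (degree ∘ f)

  ColumnFree : (Fin n → Maybe (Fin n)) → Fin n → Set
  ColumnFree f c = ∀ r → f r ≢ just c

  AgreeOutside : (Fin n → Set) → (f g : Fin n → Maybe (Fin n)) → Set
  AgreeOutside T f g = ∀ p → ¬ T p → f p ≡ g p

  agree-trans : ∀ {T} {f g h : Fin n → Maybe (Fin n)} →
    AgreeOutside T f g → AgreeOutside T g h → AgreeOutside T f h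
  agree-trans f≐g g≐h p ¬Tp = trans (f≐g p ¬Tp) (g≐h p ¬Tp)

  size-≔ : ∀ (f : Fin n → Maybe (Fin n)) r v → size (f [ r ]≔ v) + degree (f r) ≡ size f + degree v
  size-≔ f r v = trans (sum-except _ _ r λ p p≢r → cong degree (updateAt-minimal p r f p≢r))
                       (cong (λ w → size f + degree w) (updateAt-updates r f))

  module _ {f : Fin n → Maybe (Fin n)} {r : Fin n} {v : Maybe (Fin n)} where

    columnFree-≔ : ∀ {c} → (∀ p → p ≢ r → f p ≢ just c) → v ≢ just c → ColumnFree (f [ r ]≔ v) c
    columnFree-≔ c∉f-r v≢c p with p ≟ r
    ... | yes refl = λ e → v≢c (trans (sym (updateAt-updates r f)) e)
    ... | no  p≢r  = λ e → c∉f-r p p≢r (trans (sym (updateAt-minimal p r f p≢r)) e)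

    agree-≔ : ∀ {T} → T r → AgreeOutside T (f [ r ]≔ v) f
    agree-≔ Tr p ¬Tp = updateAt-minimal p r f λ { refl → ¬Tp Tr }

  incidence-≔ : (f : Fin n → Maybe (Fin n)) {i j : Fin n} → f i ≡ nothing → ∀ p q →
    incidence ((f [ i ]≔ just j) p) q ≡ incidence (f p) q + unit i j p q
  incidence-≔ f {i} {j} fi p q with p ≟ i
  ... | yes refl rewrite updateAt-updates p {λ _ → just j} f | fi | incidence-self p = sym (ℕ.+-identityʳ _)
  ... | no  p≢i  rewrite updateAt-minimal p i {λ _ → just j} f p≢i
                       | incidence-≢ (just i) p (p≢i ∘ sym ∘ just-injective) = sym (ℕ.+-identityʳ _)

-- A matching of K_{n,n} as a partial injection from rows to columns.
record Matching (n : ℕ) : Set where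
  field
    mate           : Fin n → Maybe (Fin n)
    mate-injective : ∀ {c} r r′ → mate r ≡ just c → mate r′ ≡ just c → r ≡ r′
open Matching

module _ {n : ℕ} where

  ∅ : Matching n
  ∅ = record { mate = λ _ → nothing ; mate-injective = λ _ _ () }

  column? : (M : Matching n) (c : Fin n) → (∃ λ r → mate M r ≡ just c) ⊎ ColumnFree (mate M) c
  column? M c with any? (λ r → ≡-dec _≟_ (mate M r) (just c))
  ... | yes found = inj₁ found
  ... | no  none  = inj₂ λ r eq → none (r , eq)

  columnFree? : (M : Matching n) (c : Fin n) → Dec (ColumnFree (mate M) c)
  columnFree? M c with column? M c
  ... | inj₁ (r , Mr) = no λ c∉M → c∉M r Mr
  ... | inj₂ c∉M      = yes c∉M

  mate-unique : (M : Matching n) {r c : Fin n} → mate M r ≡ just c → ∀ p → p ≢ r → mate M p ≢ just c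
  mate-unique M Mr p p≢r Mp = p≢r (mate-injective M p _ Mp Mr)

  unmatched≢matched : (M : Matching n) {i r c : Fin n} → mate M i ≡ nothing → mate M r ≡ just c → i ≢ r
  unmatched≢matched M Mi Mr refl with trans (sym Mi) Mr
  ... | ()

  reassign : (M : Matching n) (r : Fin n) (v : Maybe (Fin n)) →
    (∀ c → v ≡ just c → ColumnFree (mate M) c) → Matching n
  reassign M r v v-free = record { mate = mate M [ r ]≔ v ; mate-injective = injective }
    where
    view : ∀ p → (p ≡ r × (mate M [ r ]≔ v) p ≡ v) ⊎ ((mate M [ r ]≔ v) p ≡ mate M p)
    view p with p ≟ r
    ... | yes refl = inj₁ (refl , updateAt-updates r (mate M))
    ... | no  p≢r  = inj₂ (updateAt-minimal p r (mate M) p≢r)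
    injective : ∀ {c} p p′ → (mate M [ r ]≔ v) p ≡ just c → (mate M [ r ]≔ v) p′ ≡ just c → p ≡ p′
    injective p p′ e e′ with view p | view p′
    ... | inj₁ (refl , m) | inj₁ (refl , _) = refl
    ... | inj₁ (refl , m) | inj₂ m′         = contradiction (trans (sym m′) e′) (v-free _ (trans (sym m) e) p′)
    ... | inj₂ m          | inj₁ (refl , m′) = contradiction (trans (sym m) e) (v-free _ (trans (sym m′) e′) p)
    ... | inj₂ m          | inj₂ m′         = mate-injective M p p′ (trans (sym m) e) (trans (sym m′) e′)

  unmatch : Matching n → Fin n → Matching n
  unmatch M r = reassign M r nothing λ _ ()

  match : (M : Matching n) (r c : Fin n) → ColumnFree (mate M) c → Matching n
  match M r c c∉M = reassign M r (just c) λ { _ refl → c∉M }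

  size-unmatch : (M : Matching n) {r c : Fin n} → mate M r ≡ just c → size (mate (unmatch M r)) + 1 ≡ size (mate M)
  size-unmatch M {r} Mr = trans (cong (λ w → size (mate (unmatch M r)) + degree w) (sym Mr))
                                (trans (size-≔ (mate M) r nothing) (ℕ.+-identityʳ _))

  size-match : (M : Matching n) {r c : Fin n} → mate M r ≡ nothing → size (mate M [ r ]≔ just c) ≡ size (mate M) + 1
  size-match M {r} {c} Mr = trans (sym (ℕ.+-identityʳ _))
    (trans (cong (λ w → size (mate M [ r ]≔ just c) + degree w) (sym Mr)) (size-≔ (mate M) r (just c)))

  unmatch-columnFree : (M : Matching n) {r c : Fin n} → mate M r ≡ just c → ColumnFree (mate (unmatch M r)) c
  unmatch-columnFree M Mr = columnFree-≔ (mate-unique M Mr) λ ()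

  columnFree-unmatch : (M : Matching n) {r c : Fin n} → ColumnFree (mate M) c → ColumnFree (mate (unmatch M r)) c
  columnFree-unmatch M c∉M = columnFree-≔ (λ p _ → c∉M p) λ ()

  record SameUnion (A B A′ B′ : Matching n) : Set where
    constructor rowwise
    field samePair-at : ∀ p → SamePair (mate A p) (mate B p) (mate A′ p) (mate B′ p)
  open SameUnion public

  sameUnion-refl : ∀ {A B} → SameUnion A B A B
  sameUnion-refl = rowwise λ _ → same

  module _ {A B A′ B′ : Matching n} where

    sameUnion-flip : SameUnion A B A′ B′ → SameUnion A B B′ A′
    sameUnion-flip u = rowwise λ p → samePair-flip (samePair-at u p)

    sameUnion-columnFree : SameUnion A B A′ B′ → ∀ {c} → ColumnFree (mate A) c → ColumnFree (mate B) c →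
      ColumnFree (mate A′) c × ColumnFree (mate B′) c
    sameUnion-columnFree u c∉A c∉B = (λ p → proj₁ (free p)) , (λ p → proj₂ (free p))
      where free = λ p → samePair-all (_≢ just _) (samePair-at u p) (c∉A p) (c∉B p)

    sameUnion-size : SameUnion A B A′ B′ → size (mate A) + size (mate B) ≡ size (mate A′) + size (mate B′)
    sameUnion-size u = begin
      size (mate A) + size (mate B)                       ≡⟨ ∑-distrib-+ (degree ∘ mate A) (degree ∘ mate B) ⟨
      sum (λ p → degree (mate A p) + degree (mate B p))   ≡⟨ sum-cong-≗ (λ p → samePair-+ degree (samePair-at u p)) ⟩
      sum (λ p → degree (mate A′ p) + degree (mate B′ p)) ≡⟨ ∑-distrib-+ (degree ∘ mate A′) (degree ∘ mate B′) ⟩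
      size (mate A′) + size (mate B′)                     ∎
      where open ≡-Reasoning

    sameUnion-patch : ∀ {T} → Decidable T → ∀ {A₀ B₀ A₀′ B₀′} → SameUnion A₀ B₀ A₀′ B₀′ →
      AgreeOutside T (mate A₀) (mate A) → AgreeOutside T (mate B₀) (mate B) →
      AgreeOutside T (mate A′) (mate A₀′) → AgreeOutside T (mate B′) (mate B₀′) →
      (∀ p → T p → SamePair (mate A p) (mate B p) (mate A′ p) (mate B′ p)) → SameUnion A B A′ B′
    sameUnion-patch T? u₀ A₀≐A B₀≐B A′≐A₀′ B′≐B₀′ inside = rowwise at
      where
      at : ∀ p → SamePair (mate A p) (mate B p) (mate A′ p) (mate B′ p)
      at p with T? p
      ... | yes Tp = inside p Tp
      ... | no ¬Tp = samePair-resp (sym (A₀≐A p ¬Tp)) (sym (B₀≐B p ¬Tp)) (A′≐A₀′ p ¬Tp) (B′≐B₀′ p ¬Tp)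
                                   (samePair-at u₀ p)

-- Alternating-path exchanges between two matchings

module _ {n : ℕ} where

  transferEdge : (A B : Matching n) {r c : Fin n} → mate A r ≡ just c → mate B r ≡ nothing →
    (c∉B : ColumnFree (mate B) c) → SameUnion A B (unmatch A r) (match B r c c∉B)
  transferEdge A B {r} Ar Br c∉B =
    sameUnion-patch (_≟ r) {A₀ = A} {B₀ = B} sameUnion-refl
      (λ _ _ → refl) (λ _ _ → refl) (agree-≔ refl) (agree-≔ refl)
      λ { p refl → samePair-resp Ar Br (updateAt-updates r (mate A)) (updateAt-updates r (mate B)) swap }

  KempeSwap : (A B : Matching n) (i j : Fin n) → Set
  KempeSwap A B i j = ∃₂ λ A′ B′ → SameUnion A B A′ B′ × mate A′ i ≡ nothing × ColumnFree (mate A′) j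

  -- Follows the alternating path j –A– r –B– j′ –A– ⋯ and swaps its edges between A and B.
  kempe-acc : (A B : Matching n) → Acc _<_ (size (mate A)) → ∀ {i j} →
    mate A i ≡ nothing → ColumnFree (mate B) j → KempeSwap A B i j
  kempe-acc A B (acc rec) {i} {j} Ai j∉B with column? A j
  ... | inj₂ j∉A = A , B , sameUnion-refl , Ai , j∉A
  ... | inj₁ (r , Ar) with mate B r in Br
  ...   | nothing = unmatch A r , match B r j j∉B , transferEdge A B Ar Br j∉B ,
                    trans (updateAt-minimal i r (mate A) (unmatched≢matched A Ai Ar)) Ai , unmatch-columnFree A Ar
  ...   | just j′ with kempe-acc (unmatch A r) (unmatch B r) (rec (m+1≡n⇒m<n (size-unmatch A Ar)))
                        (trans (updateAt-minimal i r (mate A) (unmatched≢matched A Ai Ar)) Ai)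
                        (unmatch-columnFree B Br)
  ...     | A₀′ , B₀′ , u₀ , A₀′i , j′∉A₀′ =
    A′ , B′ , u , trans (updateAt-minimal i r (mate A₀′) (unmatched≢matched A Ai Ar)) A₀′i , j∉A′
    where
    j∉₀′ = sameUnion-columnFree u₀ (unmatch-columnFree A Ar) (columnFree-unmatch B j∉B)
    A′ = match A₀′ r j′ j′∉A₀′
    B′ = match B₀′ r j (proj₂ j∉₀′)
    u : SameUnion A B A′ B′
    u = sameUnion-patch (_≟ r) u₀ (agree-≔ refl) (agree-≔ refl) (agree-≔ refl) (agree-≔ refl)
      λ { p refl → samePair-resp Ar Br (updateAt-updates r (mate A₀′)) (updateAt-updates r (mate B₀′)) swap }
    j∉A′ : ColumnFree (mate A′) j
    j∉A′ = columnFree-≔ (λ p _ → proj₁ j∉₀′ p) λ { refl → j∉B r Br }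

  kempe : (A B : Matching n) {i j : Fin n} → mate A i ≡ nothing → ColumnFree (mate B) j → KempeSwap A B i j
  kempe A B = kempe-acc A B (<-wellFounded _)

  surplus? : (u v : Maybe (Fin n)) → Dec (∃ λ c → u ≡ just c × v ≡ nothing)
  surplus? nothing  v        = no λ { (_ , () , _) }
  surplus? (just c) nothing  = yes (c , refl , refl)
  surplus? (just c) (just d) = no λ { (_ , _ , ()) }

  surplus-row : (A B : Matching n) → size (mate B) < size (mate A) →
    ∃₂ λ r c → mate A r ≡ just c × mate B r ≡ nothing
  surplus-row A B B<A with any? (λ r → surplus? (mate A r) (mate B r))
  ... | yes (r , c , Ar , Br) = r , c , Ar , Br
  ... | no none = contradiction (sum-mono-≤ λ r → degree-≤ (mate A r) (mate B r) λ s → none (r , s)) (ℕ.<⇒≱ B<A)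
    where
    degree-≤ : ∀ u v → ¬ (∃ λ c → u ≡ just c × v ≡ nothing) → degree u ≤ degree v
    degree-≤ nothing  v        _  = z≤n
    degree-≤ (just c) (just d) _  = ℕ.≤-refl
    degree-≤ (just c) nothing  ¬s = contradiction (c , refl , refl) ¬s

  Rebalanced : (A B : Matching n) → Set
  Rebalanced A B = ∃₂ λ A′ B′ → SameUnion A B A′ B′ × size (mate A′) + 1 ≡ size (mate A)

  -- The alternating path
  -- r –A– c –B– r′ –A– v is contracted to the single A-edge r – v, the smaller pair (A₀, B₀) is rebalanced
  -- by induction, and the path is expanded again inside whichever of A₀′, B₀′ received the edge r – v.
  module Contract (A B : Matching n) {r r′ c : Fin n}
    (Ar : mate A r ≡ just c) (Br : mate B r ≡ nothing) (Br′ : mate B r′ ≡ just c)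
    (B<A : size (mate B) < size (mate A))
    (ih : ∀ {A₀ B₀} → size (mate B₀) < size (mate B) → size (mate B₀) < size (mate A₀) → Rebalanced A₀ B₀)
    where

    r′≢r : r′ ≢ r
    r′≢r refl with trans (sym Br) Br′
    ... | ()

    v : Maybe (Fin n)
    v = mate A r′

    A₀ B₀ : Matching n
    A₀ = reassign (unmatch A r′) r v λ _ → unmatch-columnFree A
    B₀ = unmatch B r′

    Touched : Fin n → Set
    Touched p = p ≡ r ⊎ p ≡ r′

    touched? : Decidable Touched
    touched? p = p ≟ r ⊎-dec p ≟ r′

    size-A₀ : size (mate A₀) + 1 ≡ size (mate A)
    size-A₀ = begin
      size (mate A₀) + 1                              ≡⟨ cong (λ w → size (mate A₀) + degree w) Ar′ ⟨
      size (mate A₀) + degree (mate (unmatch A r′) r) ≡⟨ size-≔ (mate (unmatch A r′)) r v ⟩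
      size (mate (unmatch A r′)) + degree v           ≡⟨ size-≔ (mate A) r′ nothing ⟩
      size (mate A) + 0                               ≡⟨ ℕ.+-identityʳ _ ⟩
      size (mate A)                                   ∎
      where
      open ≡-Reasoning
      Ar′ = trans (updateAt-minimal r r′ (mate A) (r′≢r ∘ sym)) Ar

    B₀<A₀ : size (mate B₀) < size (mate A₀)
    B₀<A₀ = ℕ.+-cancelʳ-< 1 _ _ (subst₂ _<_ (sym (size-unmatch B Br′)) (sym size-A₀) B<A)

    c∉A₀ : ColumnFree (mate A₀) c
    c∉A₀ = columnFree-≔ c∉A-r λ v≡c → r′≢r (mate-injective A r′ r v≡c Ar)
      where
      c∉A-r : ∀ p → p ≢ r → mate (unmatch A r′) p ≢ just c
      c∉A-r p p≢r with p ≟ r′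
      ... | yes refl = λ e → contradiction (trans (sym (updateAt-updates r′ (mate A))) e) λ ()
      ... | no  p≢r′ = λ e → mate-unique A Ar p p≢r (trans (sym (updateAt-minimal p r′ (mate A) p≢r′)) e)

    row-r : ∀ {A₀′ B₀′} → SameUnion A₀ B₀ A₀′ B₀′ → SamePair v nothing (mate A₀′ r) (mate B₀′ r)
    row-r u₀ = samePair-resp (sym (updateAt-updates r (mate (unmatch A r′))))
                             (sym (trans (updateAt-minimal r r′ (mate B) (r′≢r ∘ sym)) Br)) refl refl
                             (samePair-at u₀ r)

    reattach : ∀ {P Q} → SameUnion A₀ B₀ P Q → mate P r ≡ v → mate Q r ≡ nothing →
      ∃₂ λ P′ Q′ → SameUnion A B P′ Q′ × size (mate P′) ≡ size (mate P) + 1 × size (mate Q′) ≡ size (mate Q) + 1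
    reattach {P} {Q} u₀ Pr Qr = P′ , Q′ , u , size-P′ , size-match Q Qr′
      where
      A₀r′ : mate A₀ r′ ≡ nothing
      A₀r′ = trans (updateAt-minimal r′ r _ r′≢r) (updateAt-updates r′ (mate A))
      Pr′×Qr′ = samePair-all (_≡ nothing) (samePair-at u₀ r′) A₀r′ (updateAt-updates r′ (mate B))
      Pr′ = proj₁ Pr′×Qr′
      Qr′ = proj₂ Pr′×Qr′
      c∉ = sameUnion-columnFree u₀ c∉A₀ (unmatch-columnFree B Br′)
      P₁ = match P r c (proj₁ c∉)
      v-free : ∀ c′ → v ≡ just c′ → ColumnFree (mate P₁) c′
      v-free c′ v≡c′ = columnFree-≔ (mate-unique P (trans Pr v≡c′)) λ { refl → r′≢r (mate-injective A r′ r v≡c′ Ar) }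
      P′ = reassign P₁ r′ v v-free
      Q′ = match Q r′ c (proj₂ c∉)
      u : SameUnion A B P′ Q′
      u = sameUnion-patch touched? u₀
            (agree-trans (agree-≔ (inj₁ refl)) (agree-≔ (inj₂ refl))) (agree-≔ (inj₂ refl))
            (agree-trans (agree-≔ (inj₂ refl)) (agree-≔ (inj₁ refl))) (agree-≔ (inj₂ refl))
        λ { p (inj₁ refl) → samePair-resp Ar Br
                               (trans (updateAt-minimal r r′ _ (r′≢r ∘ sym)) (updateAt-updates r (mate P)))
                               (trans (updateAt-minimal r r′ (mate Q) (r′≢r ∘ sym)) Qr) same
          ; p (inj₂ refl) → samePair-resp refl Br′ (updateAt-updates r′ (mate P₁)) (updateAt-updates r′ (mate Q))
                                           same }
      size-P′ : size (mate P′) ≡ size (mate P) + 1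
      size-P′ = begin
        size (mate P′)                       ≡⟨ ℕ.+-identityʳ _ ⟨
        size (mate P′) + 0                   ≡⟨ cong (λ w → size (mate P′) + degree w) P₁r′ ⟨
        size (mate P′) + degree (mate P₁ r′) ≡⟨ size-≔ (mate P₁) r′ v ⟩
        size (mate P₁) + degree v            ≡⟨ cong (λ w → size (mate P₁) + degree w) Pr ⟨
        size (mate P₁) + degree (mate P r)   ≡⟨ size-≔ (mate P) r (just c) ⟩
        size (mate P) + 1                    ∎
        where
        open ≡-Reasoning
        P₁r′ = trans (updateAt-minimal r′ r (mate P) r′≢r) Pr′

    shrinks : ∀ {A₀′ A′ : Matching n} → size (mate A′) ≡ size (mate A₀′) + 1 →
      size (mate A₀′) + 1 ≡ size (mate A₀) → size (mate A′) + 1 ≡ size (mate A)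
    shrinks size-A′ size-A₀′ = trans (cong (_+ 1) (trans size-A′ size-A₀′)) size-A₀

    rebalanced : Rebalanced A B
    rebalanced with ih (m+1≡n⇒m<n (size-unmatch B Br′)) B₀<A₀
    ... | A₀′ , B₀′ , u₀ , size-A₀′ with samePair-inv (row-r u₀)
    ...   | inj₁ (A₀′r , B₀′r) with reattach u₀ A₀′r B₀′r
    ...     | A′ , B′ , u , size-A′ , _ = A′ , B′ , u , shrinks {A₀′} {A′} size-A′ size-A₀′
    rebalanced | A₀′ , B₀′ , u₀ , size-A₀′ | inj₂ (A₀′r , B₀′r) with reattach (sameUnion-flip u₀) B₀′r A₀′r
    ...     | B′ , A′ , u , _ , size-A′ = A′ , B′ , sameUnion-flip u , shrinks {A₀′} {A′} size-A′ size-A₀′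

  rebalance-acc : (A B : Matching n) → Acc _<_ (size (mate B)) → size (mate B) < size (mate A) → Rebalanced A B
  rebalance-acc A B (acc rec) B<A with surplus-row A B B<A
  ... | r , c , Ar , Br with column? B c
  ...   | inj₂ c∉B        = unmatch A r , match B r c c∉B , transferEdge A B Ar Br c∉B , size-unmatch A Ar
  ...   | inj₁ (r′ , Br′) = Contract.rebalanced A B Ar Br Br′ B<A λ B₀<B → rebalance-acc _ _ (rec B₀<B)

  rebalance : (A B : Matching n) → size (mate B) < size (mate A) → Rebalanced A B
  rebalance A B = rebalance-acc A B (<-wellFounded _)

-- König's edge-colouring theorem

Colouring : ℕ → ℕ → Set
Colouring t n = Fin t → Matching n

module _ {t n : ℕ} where

  multiplicity : Colouring t n → Matrix n
  multiplicity C p q = sum λ a → incidence (mate (C a) p) q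

  rowSum-multiplicity : (C : Colouring t n) → ∀ p → rowSum (multiplicity C) p ≡ sum (λ a → degree (mate (C a) p))
  rowSum-multiplicity C p =
    trans (∑-comm λ q a → incidence (mate (C a) p) q) (sum-cong-≗ λ a → ∑-incidence (mate (C a) p))

  recolour : Colouring t n → Fin t → Matching n → Fin t → Matching n → Colouring t n
  recolour C a A′ b B′ = (C [ a ]≔ A′) [ b ]≔ B′

  module _ (C : Colouring t n) {a b : Fin t} (a≢b : a ≢ b) (A′ B′ : Matching n) where

    recolour-a : recolour C a A′ b B′ a ≡ A′
    recolour-a = trans (updateAt-minimal a b _ a≢b) (updateAt-updates a C)

    recolour-b : recolour C a A′ b B′ b ≡ B′
    recolour-b = updateAt-updates b (C [ a ]≔ A′)

    recolour-other : ∀ c → c ≢ a → c ≢ b → recolour C a A′ b B′ c ≡ C c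
    recolour-other c c≢a c≢b = trans (updateAt-minimal c b _ c≢b) (updateAt-minimal c a C c≢a)

    recolour-sum : (h : Matching n → ℕ) → h (C a) + h (C b) ≡ h A′ + h B′ →
      sum (h ∘ recolour C a A′ b B′) ≡ sum (h ∘ C)
    recolour-sum h hab = sum-cong-except₂ _ _ a≢b (λ c c≢a c≢b → cong h (recolour-other c c≢a c≢b))
      (trans (cong₂ (λ M N → h M + h N) recolour-a recolour-b) (sym hab))

    multiplicity-recolour : SameUnion (C a) (C b) A′ B′ →
      ∀ p q → multiplicity (recolour C a A′ b B′) p q ≡ multiplicity C p q
    multiplicity-recolour u p q =
      recolour-sum (λ M → incidence (mate M p) q) (samePair-+ (λ v → incidence v q) (samePair-at u p))

  module _ (C : Colouring t n) (a : Fin t) {i j : Fin n}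
    (Cai : mate (C a) i ≡ nothing) (j∉Ca : ColumnFree (mate (C a)) j) where

    addEdge-at : Colouring t n
    addEdge-at = C [ a ]≔ match (C a) i j j∉Ca

    multiplicity-addEdge-at : ∀ p q → multiplicity addEdge-at p q ≡ multiplicity C p q + unit i j p q
    multiplicity-addEdge-at p q = ℕ.+-cancelʳ-≡ _ _ _ (begin
      multiplicity addEdge-at p q + incidence (mate (C a) p) q
        ≡⟨ sum-except _ _ a (λ c c≢a → cong (λ M → incidence (mate M p) q) (updateAt-minimal c a C c≢a)) ⟩
      multiplicity C p q + incidence (mate (addEdge-at a) p) q
        ≡⟨ cong (λ M → multiplicity C p q + incidence (mate M p) q) (updateAt-updates a C) ⟩
      multiplicity C p q + incidence (mate (match (C a) i j j∉Ca) p) q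
        ≡⟨ cong (multiplicity C p q +_) (incidence-≔ (mate (C a)) Cai p q) ⟩
      multiplicity C p q + (incidence (mate (C a) p) q + unit i j p q)
        ≡⟨ x∙yz≈xz∙y (multiplicity C p q) _ _ ⟩
      multiplicity C p q + unit i j p q + incidence (mate (C a) p) q ∎)
      where open ≡-Reasoning

  free-row-colour : (C : Colouring t n) (i : Fin n) → rowSum (multiplicity C) i < t →
    ∃ λ a → mate (C a) i ≡ nothing
  free-row-colour C i i-unsaturated with any? (λ a → ≡-dec _≟_ (mate (C a) i) nothing)
  ... | yes found = found
  ... | no  none  = contradiction (subst (t ≤_) (sym (rowSum-multiplicity C i)) (positive⇒≤sum matched))
                                  (ℕ.<⇒≱ i-unsaturated)
    where
    matched : ∀ a → 0 < degree (mate (C a) i)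
    matched a with mate (C a) i in Cai
    ... | just _  = z<s
    ... | nothing = contradiction (a , Cai) none

  free-column-colour : (C : Colouring t n) (j : Fin n) → colSum (multiplicity C) j < t →
    ∃ λ b → ColumnFree (mate (C b)) j
  free-column-colour C j j-unsaturated with any? (λ b → columnFree? (C b) j)
  ... | yes found = found
  ... | no  none  = contradiction (subst (t ≤_) (∑-comm λ b p → incidence (mate (C b) p) j) (positive⇒≤sum covered))
                                  (ℕ.<⇒≱ j-unsaturated)
    where
    covered : ∀ b → 0 < sum (λ p → incidence (mate (C b) p) j)
    covered b with column? (C b) j
    ... | inj₂ j∉Cb     = contradiction (b , j∉Cb) none
    ... | inj₁ (r , Cbr) = ℕ.<-≤-trans (subst (0 <_) Cbr-incident z<s) (≤-sum _ r)
      where Cbr-incident = sym (trans (cong (λ w → incidence w j) Cbr) (incidence-self j))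

  addEdge : (C : Colouring t n) {i j : Fin n} → rowSum (multiplicity C) i < t → colSum (multiplicity C) j < t →
    ∃ λ (C′ : Colouring t n) → ∀ p q → multiplicity C′ p q ≡ multiplicity C p q + unit i j p q
  addEdge C {i} {j} i-unsaturated j-unsaturated
    with free-row-colour C i i-unsaturated | free-column-colour C j j-unsaturated
  ... | a , Cai | b , j∉Cb with a ≟ b
  ...   | yes refl = addEdge-at C a Cai j∉Cb , multiplicity-addEdge-at C a Cai j∉Cb
  ...   | no  a≢b with kempe (C a) (C b) Cai j∉Cb
  ...     | A′ , B′ , u , A′i , j∉A′ = addEdge-at C₁ a C₁ai j∉C₁a , λ p q →
    trans (multiplicity-addEdge-at C₁ a C₁ai j∉C₁a p q)
          (cong (_+ unit i j p q) (multiplicity-recolour C a≢b A′ B′ u p q))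
    where
    C₁ = recolour C a A′ b B′
    C₁ai : mate (C₁ a) i ≡ nothing
    C₁ai = subst (λ M → mate M i ≡ nothing) (sym (recolour-a C a≢b A′ B′)) A′i
    j∉C₁a : ColumnFree (mate (C₁ a)) j
    j∉C₁a = subst (λ M → ColumnFree (mate M) j) (sym (recolour-a C a≢b A′ B′)) j∉A′

  module Decrement (X : Matrix n) {i j : Fin n} (0<Xij : 0 < X i j) where

    X′ : Matrix n
    X′ p q = X p q ∸ unit i j p q

    unit≤X : ∀ p q → unit i j p q ≤ X p q
    unit≤X p q with p ≟ i | q ≟ j
    ... | yes refl | yes refl rewrite incidence-self p | incidence-self q = 0<Xij
    ... | yes refl | no  q≢j  rewrite incidence-≢ (just j) q (q≢j ∘ sym ∘ just-injective)
                                    | ℕ.*-zeroʳ (incidence (just i) p) = z≤n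
    ... | no  p≢i  | _        rewrite incidence-≢ (just i) p (p≢i ∘ sym ∘ just-injective) = z≤n

    X′+unit : ∀ p q → X′ p q + unit i j p q ≡ X p q
    X′+unit p q = ℕ.m∸n+n≡m (unit≤X p q)

    rowSum-X′ : ∀ p → rowSum X′ p + incidence (just i) p ≡ rowSum X p
    rowSum-X′ p = begin
      rowSum X′ p + incidence (just i) p ≡⟨ cong (rowSum X′ p +_) (rowSum-unit i j p) ⟨
      rowSum X′ p + rowSum (unit i j) p  ≡⟨ ∑-distrib-+ (X′ p) (unit i j p) ⟨
      sum (λ q → X′ p q + unit i j p q)  ≡⟨ sum-cong-≗ (X′+unit p) ⟩
      rowSum X p                         ∎
      where open ≡-Reasoning

    colSum-X′ : ∀ q → colSum X′ q + incidence (just j) q ≡ colSum X q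
    colSum-X′ q = begin
      colSum X′ q + incidence (just j) q ≡⟨ cong (colSum X′ q +_) (colSum-unit i j q) ⟨
      colSum X′ q + colSum (unit i j) q  ≡⟨ ∑-distrib-+ (λ p → X′ p q) (λ p → unit i j p q) ⟨
      sum (λ p → X′ p q + unit i j p q)  ≡⟨ sum-cong-≗ (λ p → X′+unit p q) ⟩
      colSum X q                         ∎
      where open ≡-Reasoning

    total-X′ : total X′ + 1 ≡ total X
    total-X′ = begin
      total X′ + 1                                   ≡⟨ cong (total X′ +_) (∑-incidence (just i)) ⟨
      total X′ + sum (incidence (just i))            ≡⟨ ∑-distrib-+ (rowSum X′) (incidence (just i)) ⟨
      sum (λ p → rowSum X′ p + incidence (just i) p) ≡⟨ sum-cong-≗ rowSum-X′ ⟩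
      total X                                        ∎
      where open ≡-Reasoning

    rowSum-X′≤ : ∀ p → rowSum X′ p ≤ rowSum X p
    rowSum-X′≤ p = ℕ.≤-trans (ℕ.m≤m+n _ _) (ℕ.≤-reflexive (rowSum-X′ p))

    colSum-X′≤ : ∀ q → colSum X′ q ≤ colSum X q
    colSum-X′≤ q = ℕ.≤-trans (ℕ.m≤m+n _ _) (ℕ.≤-reflexive (colSum-X′ q))

    extend : rowSum X i ≤ t → colSum X j ≤ t → (∃ λ (C : Colouring t n) → ∀ p q → multiplicity C p q ≡ X′ p q) →
      ∃ λ (C : Colouring t n) → ∀ p q → multiplicity C p q ≡ X p q
    extend row-i col-j (C , C≗X′) = C′ , λ p q →
      trans (C′≗C+unit p q) (trans (cong (_+ unit i j p q) (C≗X′ p q)) (X′+unit p q))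
      where
      i-unsaturated : rowSum (multiplicity C) i < t
      i-unsaturated = ℕ.<-≤-trans (subst (_< rowSum X i) (sym (sum-cong-≗ (C≗X′ i)))
        (m+1≡n⇒m<n (subst (λ w → rowSum X′ i + w ≡ rowSum X i) (incidence-self i) (rowSum-X′ i)))) row-i
      j-unsaturated : colSum (multiplicity C) j < t
      j-unsaturated = ℕ.<-≤-trans (subst (_< colSum X j) (sym (sum-cong-≗ λ p → C≗X′ p j))
        (m+1≡n⇒m<n (subst (λ w → colSum X′ j + w ≡ colSum X j) (incidence-self j) (colSum-X′ j)))) col-j
      C′ = proj₁ (addEdge C i-unsaturated j-unsaturated)
      C′≗C+unit = proj₂ (addEdge C i-unsaturated j-unsaturated)

  colouring-acc : (X : Matrix n) → Acc _<_ (total X) → (∀ p → rowSum X p ≤ t) → (∀ q → colSum X q ≤ t) →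
    ∃ λ (C : Colouring t n) → ∀ p q → multiplicity C p q ≡ X p q
  colouring-acc X (acc rec) rows cols with any? (λ i → any? (λ j → 0 ℕ.<? X i j))
  ... | no  none = (λ _ → ∅) , λ p q →
    trans (sum-replicate-zero t) (sym (ℕ.n≤0⇒n≡0 (ℕ.≮⇒≥ λ pos → none (p , q , pos))))
  ... | yes (i , j , 0<Xij) = extend (rows i) (cols j)
    (colouring-acc X′ (rec (m+1≡n⇒m<n total-X′))
                      (λ p → ℕ.≤-trans (rowSum-X′≤ p) (rows p)) (λ q → ℕ.≤-trans (colSum-X′≤ q) (cols q)))
    where open Decrement X 0<Xij

  colouring : (X : Matrix n) → (∀ p → rowSum X p ≤ t) → (∀ q → colSum X q ≤ t) →
    ∃ λ (C : Colouring t n) → ∀ p q → multiplicity C p q ≡ X p q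
  colouring X = colouring-acc X (<-wellFounded _)

  -- Equalising the colour classes

  excess : ℕ → Colouring t n → ℕ
  excess k C = sum λ a → size (mate (C a)) ∸ k

  module Transfer (k : ℕ) (C : Colouring t n) {a b : Fin t}
    (k<Ca : k < size (mate (C a))) (Cb<k : size (mate (C b)) < k) where

    a≢b : a ≢ b
    a≢b refl = ℕ.<-asym k<Ca Cb<k

    rebalanced = rebalance (C a) (C b) (ℕ.<-trans Cb<k k<Ca)
    A′ = proj₁ rebalanced
    B′ = proj₁ (proj₂ rebalanced)
    u = proj₁ (proj₂ (proj₂ rebalanced))
    size-A′ = proj₂ (proj₂ (proj₂ rebalanced))

    C′ : Colouring t n
    C′ = recolour C a A′ b B′

    multiplicity-C′ : ∀ p q → multiplicity C′ p q ≡ multiplicity C p q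
    multiplicity-C′ = multiplicity-recolour C a≢b A′ B′ u

    sizes-C′ : sum (λ c → size (mate (C′ c))) ≡ sum (λ c → size (mate (C c)))
    sizes-C′ = recolour-sum C a≢b A′ B′ (size ∘ mate) (sameUnion-size u)

    excess-C′ : excess k C′ < excess k C
    excess-C′ = sum-mono-< a pointwise at-a
      where
      size-B′ : size (mate B′) ≡ size (mate (C b)) + 1
      size-B′ = ℕ.+-cancelˡ-≡ (size (mate A′)) _ _ (begin
        size (mate A′) + size (mate B′)          ≡⟨ sameUnion-size u ⟨
        size (mate (C a)) + size (mate (C b))    ≡⟨ cong (_+ size (mate (C b))) size-A′ ⟨
        size (mate A′) + 1 + size (mate (C b))   ≡⟨ xy∙z≈xz∙y (size (mate A′)) 1 _ ⟩
        size (mate A′) + size (mate (C b)) + 1   ≡⟨ ℕ.+-assoc (size (mate A′)) _ 1 ⟩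
        size (mate A′) + (size (mate (C b)) + 1) ∎)
        where open ≡-Reasoning
      k≤A′ : k ≤ size (mate A′)
      k≤A′ = ℕ.+-cancelʳ-≤ 1 k _ (subst (k + 1 ≤_) (sym size-A′) (subst (_≤ size (mate (C a))) (ℕ.+-comm 1 k) k<Ca))
      at-a : size (mate (C′ a)) ∸ k < size (mate (C a)) ∸ k
      at-a rewrite recolour-a C a≢b A′ B′ = ℕ.∸-monoˡ-< (m+1≡n⇒m<n size-A′) k≤A′
      B′≤k : size (mate B′) ≤ k
      B′≤k = subst (_≤ k) (trans (ℕ.+-comm 1 _) (sym size-B′)) Cb<k
      pointwise : ∀ c → size (mate (C′ c)) ∸ k ≤ size (mate (C c)) ∸ k
      pointwise c with c ≟ a | c ≟ b
      ... | yes refl | _        = ℕ.<⇒≤ at-a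
      ... | no  _    | yes refl rewrite recolour-b C a≢b A′ B′ | ℕ.m≤n⇒m∸n≡0 B′≤k = z≤n
      ... | no  c≢a  | no  c≢b  =
        ℕ.≤-reflexive (cong (λ M → size (mate M) ∸ k) (recolour-other C a≢b A′ B′ c c≢a c≢b))

  Equalized : ℕ → Colouring t n → Set
  Equalized k C =
    ∃ λ (C′ : Colouring t n) → (∀ p q → multiplicity C′ p q ≡ multiplicity C p q) × (∀ a → size (mate (C′ a)) ≡ k)

  equalize-acc : ∀ k (C : Colouring t n) → Acc _<_ (excess k C) → sum (λ a → size (mate (C a))) ≡ t * k →
    Equalized k C
  equalize-acc k C (acc rec) sizes with any? (λ a → k ℕ.<? size (mate (C a)))
  ... | no  none       = C , (λ _ _ → refl) , sum≡n*k⇒≡k _ sizes (λ a → ℕ.≮⇒≥ λ k<Ca → none (a , k<Ca))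
  ... | yes (a , k<Ca) with sum≡n*k⇒deficit _ sizes k<Ca
  ...   | b , Cb<k with equalize-acc k C′ (rec excess-C′) (trans sizes-C′ sizes)
    where open Transfer k C {a} {b} k<Ca Cb<k
  ...     | C″ , C″≗C′ , sizes-C″ = C″ , (λ p q → trans (C″≗C′ p q) (multiplicity-C′ p q)) , sizes-C″
    where open Transfer k C {a} {b} k<Ca Cb<k

  equalize : ∀ k (C : Colouring t n) → sum (λ a → size (mate (C a))) ≡ t * k → Equalized k C
  equalize k C = equalize-acc k C (<-wellFounded _)

  sizes≡total : (C : Colouring t n) → sum (λ a → size (mate (C a))) ≡ total (multiplicity C)
  sizes≡total C = sym (trans (sum-cong-≗ (rowSum-multiplicity C)) (∑-comm λ p a → degree (mate (C a) p)))

  decompose : (k : ℕ) (X : Matrix n) → (∀ p → rowSum X p ≤ t) → (∀ q → colSum X q ≤ t) → total X ≡ t * k →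
    ∃ λ (C : Colouring t n) → (∀ p q → multiplicity C p q ≡ X p q) × (∀ a → size (mate (C a)) ≡ k)
  decompose k X rows cols total≡tk with colouring X rows cols
  ... | C , C≗X with equalize k C (trans (sizes≡total C) (trans (sum-cong-≗ λ p → sum-cong-≗ (C≗X p)) total≡tk))
  ...   | C′ , C′≗C , sizes = C′ , (λ p q → trans (C′≗C p q) (C≗X p q)) , sizes

-- Linear functionals on the polytope

fromℕ : ℕ → ℚ
fromℕ m = ℤ.+ m / 1

fromℕ≡mkℚ : ∀ m → fromℕ m ≡ mkℚ (ℤ.+ m) 0 (Coprime.sym (Coprime.1-coprimeTo m))
fromℕ≡mkℚ m = ℚ.normalize-coprime (Coprime.sym (Coprime.1-coprimeTo m))

fromℕ-cancel-≤ : ∀ {a b} → fromℕ a ℚ.≤ fromℕ b → a ≤ b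
fromℕ-cancel-≤ {a} {b} le rewrite fromℕ≡mkℚ a | fromℕ≡mkℚ b with le
... | *≤* a*1≤b*1 = ℤ.drop‿+≤+ (subst₂ ℤ._≤_ (ℤ.*-identityʳ (ℤ.+ a)) (ℤ.*-identityʳ (ℤ.+ b)) a*1≤b*1)

fromℕ-mono-≤ : ∀ {a b} → a ≤ b → fromℕ a ℚ.≤ fromℕ b
fromℕ-mono-≤ {a} {b} a≤b rewrite fromℕ≡mkℚ a | fromℕ≡mkℚ b =
  *≤* (subst₂ ℤ._≤_ (sym (ℤ.*-identityʳ (ℤ.+ a))) (sym (ℤ.*-identityʳ (ℤ.+ b))) (ℤ.+≤+ a≤b))

fromℕ-+ : ∀ a b → fromℕ (a + b) ≡ fromℕ a ℚ.+ fromℕ b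
fromℕ-+ a b = ℚ.toℚᵘ-injective (ℚᵘ.≃-trans unnormalised (ℚᵘ.≃-sym (ℚ.toℚᵘ-homo-+ (fromℕ a) (fromℕ b))))
  where
  unnormalised : ℚ.toℚᵘ (fromℕ (a + b)) ℚᵘ.≃ ℚ.toℚᵘ (fromℕ a) ℚᵘ.+ ℚ.toℚᵘ (fromℕ b)
  unnormalised rewrite fromℕ≡mkℚ (a + b) | fromℕ≡mkℚ a | fromℕ≡mkℚ b = ℚᵘ.*≡* (cong (ℤ._* ℤ.+ 1)
    (trans (ℤ.pos-+ a b) (sym (cong₂ ℤ._+_ (ℤ.*-identityʳ (ℤ.+ a)) (ℤ.*-identityʳ (ℤ.+ b))))))

fromℕ-* : ∀ a b → fromℕ (a * b) ≡ fromℕ a ℚ.* fromℕ b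
fromℕ-* a b = ℚ.toℚᵘ-injective (ℚᵘ.≃-trans unnormalised (ℚᵘ.≃-sym (ℚ.toℚᵘ-homo-* (fromℕ a) (fromℕ b))))
  where
  unnormalised : ℚ.toℚᵘ (fromℕ (a * b)) ℚᵘ.≃ ℚ.toℚᵘ (fromℕ a) ℚᵘ.* ℚ.toℚᵘ (fromℕ b)
  unnormalised rewrite fromℕ≡mkℚ (a * b) | fromℕ≡mkℚ a | fromℕ≡mkℚ b = ℚᵘ.*≡* (cong (ℤ._* ℤ.+ 1) (ℤ.pos-* a b))

nonNegative⇒ℕ : ∀ (z : ℤ) → 0ℚ ℚ.≤ z / 1 → ∃ λ m → z ≡ ℤ.+ m
nonNegative⇒ℕ (ℤ.+ m)  _  = m , refl
nonNegative⇒ℕ -[1+ m ] le rewrite ℚ.normalize-coprime {suc m} {0} (Coprime.sym (Coprime.1-coprimeTo (suc m)))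
  with le
... | *≤* 0*1≤z*1 with subst₂ ℤ._≤_ (ℤ.*-zeroˡ (ℤ.+ 1)) (ℤ.*-identityʳ -[1+ m ]) 0*1≤z*1
...   | ()

sumℚ-fromℕ : ∀ {m} (f : Fin m → ℕ) → sumℚ (fromℕ ∘ f) ≡ fromℕ (sum f)
sumℚ-fromℕ {zero}  f = refl
sumℚ-fromℕ {suc m} f = trans (cong (fromℕ (f zero) ℚ.+_) (sumℚ-fromℕ (f ∘ suc))) (sym (fromℕ-+ (f zero) _))

record LinearFunctional (n : ℕ) : Set where
  field
    φ      : QPoint n → ℚ
    φ-cong : ∀ {y z : QPoint n} → (∀ i j → y i j ≡ z i j) → φ y ≡ φ z
    φ-+    : ∀ (y z : QPoint n) → φ (λ i j → y i j ℚ.+ z i j) ≡ φ y ℚ.+ φ z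
    φ-*    : ∀ a (y : QPoint n) → φ (λ i j → a ℚ.* y i j) ≡ a ℚ.* φ y
    ψ      : Matrix n → ℕ
    φ-ψ    : ∀ (X : Matrix n) → φ (λ i j → fromℕ (X i j)) ≡ fromℕ (ψ X)
open LinearFunctional

coordinate : ∀ {n} → Fin n → Fin n → LinearFunctional n
coordinate i j = record
  { φ = λ y → y i j ; φ-cong = λ y≗z → y≗z i j ; φ-+ = λ _ _ → refl ; φ-* = λ _ _ → refl
  ; ψ = λ X → X i j ; φ-ψ = λ _ → refl }

sumOf : ∀ {m n} → (Fin m → LinearFunctional n) → LinearFunctional n
sumOf L = record
  { φ      = λ y → sumℚ λ k → φ (L k) y
  ; φ-cong = λ y≗z → sumℚ-cong-≗ λ k → φ-cong (L k) y≗z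
  ; φ-+    = λ y z → trans (sumℚ-cong-≗ λ k → φ-+ (L k) y z) (sumℚ-distrib-+ (λ k → φ (L k) y) (λ k → φ (L k) z))
  ; φ-*    = λ a y → trans (sumℚ-cong-≗ λ k → φ-* (L k) a y) (sym (*-distribˡ-sumℚ a λ k → φ (L k) y))
  ; ψ      = λ X → sum λ k → ψ (L k) X
  ; φ-ψ    = λ X → trans (sumℚ-cong-≗ λ k → φ-ψ (L k) X) (sumℚ-fromℕ λ k → ψ (L k) X) }

rowSumℚ colSumℚ : ∀ {n} → Fin n → LinearFunctional n
rowSumℚ i = sumOf (coordinate i)
colSumℚ j = sumOf λ i → coordinate i j

totalℚ : ∀ {n} → LinearFunctional n
totalℚ = sumOf rowSumℚ

module _ {n k : ℕ} (L : LinearFunctional n) where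

  φ-zero : φ L (λ _ _ → 0ℚ) ≡ 0ℚ
  φ-zero = trans (φ-cong L λ _ _ → sym (ℚ.*-zeroˡ 0ℚ)) (trans (φ-* L 0ℚ (λ _ _ → 0ℚ)) (ℚ.*-zeroˡ (φ L λ _ _ → 0ℚ)))

  φ-combo : ∀ λ₀ (M : KMatching n k) Λ → φ L (combo ((λ₀ , M) ∷ Λ)) ≡ λ₀ ℚ.* φ L (χ (proj₁ M)) ℚ.+ φ L (combo Λ)
  φ-combo λ₀ (M , _) Λ = trans (φ-+ L _ (combo Λ)) (cong (ℚ._+ φ L (combo Λ)) (φ-* L λ₀ (χ M)))

  scale-sum : ∀ c λ₀ s → λ₀ ℚ.* c ℚ.+ c ℚ.* s ≡ c ℚ.* (λ₀ ℚ.+ s)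
  scale-sum c λ₀ s = trans (cong (ℚ._+ c ℚ.* s) (ℚ.*-comm λ₀ c)) (sym (ℚ.*-distribˡ-+ c λ₀ s))

  combo-≤ : ∀ {c} → (∀ (M : KMatching n k) → φ L (χ (proj₁ M)) ℚ.≤ c) →
    ∀ Λ → AllNonneg Λ → φ L (combo Λ) ℚ.≤ c ℚ.* sumCoeffs Λ
  combo-≤ {c} bound [] _ = ℚ.≤-reflexive (trans φ-zero (sym (ℚ.*-zeroʳ c)))
  combo-≤ {c} bound ((λ₀ , M) ∷ Λ) (0≤λ₀ , nonneg) = begin
    φ L (combo ((λ₀ , M) ∷ Λ))                 ≡⟨ φ-combo λ₀ M Λ ⟩
    λ₀ ℚ.* φ L (χ (proj₁ M)) ℚ.+ φ L (combo Λ) ≤⟨ ℚ.+-mono-≤ (ℚ.*-monoˡ-≤-nonNeg λ₀ {{ℚ.nonNegative 0≤λ₀}} (bound M))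
                                                             (combo-≤ bound Λ nonneg) ⟩
    λ₀ ℚ.* c ℚ.+ c ℚ.* sumCoeffs Λ             ≡⟨ scale-sum c λ₀ (sumCoeffs Λ) ⟩
    c ℚ.* (λ₀ ℚ.+ sumCoeffs Λ)                 ∎
    where open ℚ.≤-Reasoning

  combo-≥ : ∀ {c} → (∀ (M : KMatching n k) → c ℚ.≤ φ L (χ (proj₁ M))) →
    ∀ Λ → AllNonneg Λ → c ℚ.* sumCoeffs Λ ℚ.≤ φ L (combo Λ)
  combo-≥ {c} bound [] _ = ℚ.≤-reflexive (trans (ℚ.*-zeroʳ c) (sym φ-zero))
  combo-≥ {c} bound ((λ₀ , M) ∷ Λ) (0≤λ₀ , nonneg) = begin
    c ℚ.* (λ₀ ℚ.+ sumCoeffs Λ)                 ≡⟨ scale-sum c λ₀ (sumCoeffs Λ) ⟨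
    λ₀ ℚ.* c ℚ.+ c ℚ.* sumCoeffs Λ             ≤⟨ ℚ.+-mono-≤ (ℚ.*-monoˡ-≤-nonNeg λ₀ {{ℚ.nonNegative 0≤λ₀}} (bound M))
                                                             (combo-≥ bound Λ nonneg) ⟩
    λ₀ ℚ.* φ L (χ (proj₁ M)) ℚ.+ φ L (combo Λ) ≡⟨ φ-combo λ₀ M Λ ⟨
    φ L (combo ((λ₀ , M) ∷ Λ))                 ∎
    where open ℚ.≤-Reasoning

  InMk-≤ : ∀ {c y} → (∀ (M : KMatching n k) → φ L (χ (proj₁ M)) ℚ.≤ c) → InMk n k y → φ L y ℚ.≤ c
  InMk-≤ {c} bound (Λ , nonneg , ∑λ≡1 , y≗combo) = begin
    φ L _             ≡⟨ φ-cong L y≗combo ⟩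
    φ L (combo Λ)     ≤⟨ combo-≤ bound Λ nonneg ⟩
    c ℚ.* sumCoeffs Λ ≡⟨ cong (c ℚ.*_) ∑λ≡1 ⟩
    c ℚ.* 1ℚ          ≡⟨ ℚ.*-identityʳ c ⟩
    c                 ∎
    where open ℚ.≤-Reasoning

  InMk-≥ : ∀ {c y} → (∀ (M : KMatching n k) → c ℚ.≤ φ L (χ (proj₁ M))) → InMk n k y → c ℚ.≤ φ L y
  InMk-≥ {c} bound (Λ , nonneg , ∑λ≡1 , y≗combo) = begin
    c                 ≡⟨ ℚ.*-identityʳ c ⟨
    c ℚ.* 1ℚ          ≡⟨ cong (c ℚ.*_) ∑λ≡1 ⟨
    c ℚ.* sumCoeffs Λ ≤⟨ combo-≥ bound Λ nonneg ⟩
    φ L (combo Λ)     ≡⟨ φ-cong L y≗combo ⟨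
    φ L _             ∎
    where open ℚ.≤-Reasoning

module _ {n : ℕ} where

  indicator : EdgeSet n → Matrix n
  indicator M i j = 𝟙 (M i j)

  χ≡fromℕ : ∀ (M : EdgeSet n) i j → χ M i j ≡ fromℕ (indicator M i j)
  χ≡fromℕ M i j with M i j
  ... | true  = refl
  ... | false = refl

  φ-χ : (L : LinearFunctional n) (M : EdgeSet n) → φ L (χ M) ≡ fromℕ (ψ L (indicator M))
  φ-χ L M = trans (φ-cong L (χ≡fromℕ M)) (φ-ψ L (indicator M))

  numEdges≡total : ∀ (M : EdgeSet n) → numEdges M ≡ total (indicator M)
  numEdges≡total M = trans (sumFinℕ≡sum λ i → sumFinℕ (indicator M i)) (sum-cong-≗ λ i → sumFinℕ≡sum (indicator M i))

sum-𝟙≤1 : ∀ {n} (b : Fin n → Bool) → (∀ j j′ → b j ≡ true → b j′ ≡ true → j ≡ j′) → sum (𝟙 ∘ b) ≤ 1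
sum-𝟙≤1 {zero}  b unique = z≤n
sum-𝟙≤1 {suc n} b unique with b zero in b₀
... | true  = ℕ.≤-reflexive (cong suc (trans (sum-cong-≗ rest-false) (sum-replicate-zero n)))
  where
  rest-false : ∀ j → 𝟙 (b (suc j)) ≡ 0
  rest-false j with b (suc j) in bj
  ... | true  = contradiction (unique (suc j) zero bj b₀) λ ()
  ... | false = refl
... | false = sum-𝟙≤1 (b ∘ suc) λ j j′ bj bj′ → suc-injective (unique (suc j) (suc j′) bj bj′)

module IntegerPoint {n k t : ℕ} (x : ZPoint n) (x∈tMk : InDilate n k t (toQ x)) where

  y : QPoint n
  y = proj₁ x∈tMk

  y∈Mk : InMk n k y
  y∈Mk = proj₁ (proj₂ x∈tMk)

  x≡ty : ∀ i j → x i j / 1 ≡ fromℕ t ℚ.* y i j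
  x≡ty = proj₂ (proj₂ x∈tMk)

  instance
    t-nonNeg : ℚ.NonNegative (fromℕ t)
    t-nonNeg = ℚ.normalize-nonNeg t 1

  entry-nonNeg : ∀ i j → 0ℚ ℚ.≤ x i j / 1
  entry-nonNeg i j = begin
    0ℚ                ≡⟨ ℚ.*-zeroʳ (fromℕ t) ⟨
    fromℕ t ℚ.* 0ℚ    ≤⟨ ℚ.*-monoˡ-≤-nonNeg (fromℕ t) (InMk-≥ (coordinate i j) χ-nonNeg y∈Mk) ⟩
    fromℕ t ℚ.* y i j ≡⟨ x≡ty i j ⟨
    x i j / 1         ∎
    where
    open ℚ.≤-Reasoning
    χ-nonNeg : ∀ (M : KMatching n k) → 0ℚ ℚ.≤ χ (proj₁ M) i j
    χ-nonNeg (M , _) = subst (0ℚ ℚ.≤_) (sym (χ≡fromℕ M i j)) (fromℕ-mono-≤ {0} {indicator M i j} z≤n)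

  X : Matrix n
  X i j = proj₁ (nonNegative⇒ℕ (x i j) (entry-nonNeg i j))

  x≡X : ∀ i j → x i j ≡ ℤ.+ X i j
  x≡X i j = proj₂ (nonNegative⇒ℕ (x i j) (entry-nonNeg i j))

  ψ-X : (L : LinearFunctional n) → fromℕ (ψ L X) ≡ fromℕ t ℚ.* φ L y
  ψ-X L = trans (sym (φ-ψ L X)) (trans (φ-cong L λ i j → trans (cong (_/ 1) (sym (x≡X i j))) (x≡ty i j))
                                       (φ-* L (fromℕ t) y))

  ψ-≤ : (L : LinearFunctional n) {c : ℕ} → (∀ (M : KMatching n k) → ψ L (indicator (proj₁ M)) ≤ c) → ψ L X ≤ t * c
  ψ-≤ L {c} bound = fromℕ-cancel-≤ (begin
    fromℕ (ψ L X)       ≡⟨ ψ-X L ⟩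
    fromℕ t ℚ.* φ L y   ≤⟨ ℚ.*-monoˡ-≤-nonNeg (fromℕ t) (InMk-≤ L vertex-bound y∈Mk) ⟩
    fromℕ t ℚ.* fromℕ c ≡⟨ fromℕ-* t c ⟨
    fromℕ (t * c)       ∎)
    where
    open ℚ.≤-Reasoning
    vertex-bound : ∀ (M : KMatching n k) → φ L (χ (proj₁ M)) ℚ.≤ fromℕ c
    vertex-bound M = subst (ℚ._≤ fromℕ c) (sym (φ-χ L (proj₁ M))) (fromℕ-mono-≤ (bound M))

  ψ-≥ : (L : LinearFunctional n) {c : ℕ} → (∀ (M : KMatching n k) → c ≤ ψ L (indicator (proj₁ M))) → t * c ≤ ψ L X
  ψ-≥ L {c} bound = fromℕ-cancel-≤ (begin
    fromℕ (t * c)       ≡⟨ fromℕ-* t c ⟩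
    fromℕ t ℚ.* fromℕ c ≤⟨ ℚ.*-monoˡ-≤-nonNeg (fromℕ t) (InMk-≥ L vertex-bound y∈Mk) ⟩
    fromℕ t ℚ.* φ L y   ≡⟨ ψ-X L ⟨
    fromℕ (ψ L X)       ∎)
    where
    open ℚ.≤-Reasoning
    vertex-bound : ∀ (M : KMatching n k) → fromℕ c ℚ.≤ φ L (χ (proj₁ M))
    vertex-bound M = subst (fromℕ c ℚ.≤_) (sym (φ-χ L (proj₁ M))) (fromℕ-mono-≤ (bound M))

  rowSum-≤ : ∀ p → rowSum X p ≤ t
  rowSum-≤ p = subst (rowSum X p ≤_) (ℕ.*-identityʳ t)
    (ψ-≤ (rowSumℚ p) λ (M , (one-per-row , _) , _) → sum-𝟙≤1 (M p) (one-per-row p))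

  colSum-≤ : ∀ q → colSum X q ≤ t
  colSum-≤ q = subst (colSum X q ≤_) (ℕ.*-identityʳ t)
    (ψ-≤ (colSumℚ q) λ (M , (_ , one-per-column) , _) → sum-𝟙≤1 (λ p → M p q) λ p p′ → one-per-column p p′ q)

  total-≡ : total X ≡ t * k
  total-≡ = ℕ.≤-antisym (ψ-≤ totalℚ (ℕ.≤-reflexive ∘ edges)) (ψ-≥ totalℚ (ℕ.≤-reflexive ∘ sym ∘ edges))
    where
    edges : ∀ (M : KMatching n k) → total (indicator (proj₁ M)) ≡ k
    edges (M , _ , |M|≡k) = trans (sym (numEdges≡total M)) |M|≡k

module _ {n : ℕ} where

  edgeSet : Matching n → EdgeSet n
  edgeSet M i j = isMate (mate M i) j

  edgeSet-isMatching : (M : Matching n) → IsMatching (edgeSet M)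
  edgeSet-isMatching M =
      (λ i j j′ e e′ → just-injective (trans (sym (isMate⇒≡ (mate M i) j e)) (isMate⇒≡ (mate M i) j′ e′)))
    , (λ i i′ j e e′ → mate-injective M i i′ (isMate⇒≡ (mate M i) j e) (isMate⇒≡ (mate M i′) j e′))

  matching∈Mk : ∀ {k} (M : Matching n) → size (mate M) ≡ k → InMk n k (toQ λ i j → ℤ.+ incidence (mate M i) j)
  matching∈Mk M |M|≡k =
    ((1ℚ , edgeSet M , edgeSet-isMatching M , |E|≡k) ∷ []) , (*≤* (ℤ.+≤+ z≤n) , tt) , refl , pointwise
    where
    |E|≡k : numEdges (edgeSet M) ≡ _
    |E|≡k = trans (numEdges≡total (edgeSet M)) (trans (sum-cong-≗ λ i → ∑-incidence (mate M i)) |M|≡k)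
    pointwise : ∀ i j → ℤ.+ incidence (mate M i) j / 1 ≡ 1ℚ ℚ.* χ (edgeSet M) i j ℚ.+ 0ℚ
    pointwise i j with isMate (mate M i) j
    ... | true  = refl
    ... | false = refl

sumPts-tabulate : ∀ {n t} (P : Fin t → Matrix n) i j →
  sumPts (tabulate λ a i j → ℤ.+ P a i j) i j ≡ ℤ.+ sum (λ a → P a i j)
sumPts-tabulate {t = zero}  P i j = refl
sumPts-tabulate {t = suc t} P i j =
  trans (cong (ℤ._+_ (ℤ.+ P zero i j)) (sumPts-tabulate (P ∘ suc) i j)) (sym (ℤ.pos-+ (P zero i j) _))

allIn-tabulate : ∀ {n t} {Q : ZPoint n → Set} (f : Fin t → ZPoint n) → (∀ a → Q (f a)) → AllIn Q (tabulate f)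
allIn-tabulate {t = zero}  f Qf = tt
allIn-tabulate {t = suc t} f Qf = Qf zero , allIn-tabulate (f ∘ suc) (Qf ∘ suc)

proposition4p7 : ∀ (n : ℕ) → 1 ≤ n → ∀ (k : ℕ) → k ≤ n → MkNormal n k
proposition4p7 n _ k _ t _ x x∈tMk =
  tabulate point , allIn-tabulate point (λ a → matching∈Mk (C a) (size-C a)) , x≡∑points
  where
  open IntegerPoint {k = k} {t = t} x x∈tMk
  decomposition = decompose k X rowSum-≤ colSum-≤ total-≡
  C = proj₁ decomposition
  C≗X = proj₁ (proj₂ decomposition)
  size-C = proj₂ (proj₂ decomposition)
  point : Fin t → ZPoint n
  point a i j = ℤ.+ incidence (mate (C a) i) j
  x≡∑points : ∀ i j → x i j ≡ sumPts (tabulate point) i j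
  x≡∑points i j = begin
    x i j                                     ≡⟨ x≡X i j ⟩
    ℤ.+ X i j                                 ≡⟨ cong ℤ.+_ (C≗X i j) ⟨
    ℤ.+ multiplicity C i j                    ≡⟨ sumPts-tabulate (λ a i j → incidence (mate (C a) i) j) i j ⟨
    sumPts (tabulate point) i j               ∎
    where open ≡-Reasoning
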